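{- For $n\ge 1$ let $a_n = |S_n^2(132,321)|$. Then $a_1=1$ and $a_{n+1} = a_n + n(n+2)$ for all $n\ge 1$.
   Context: A $3$-permutation of size $n$ is an ordered pair $(\sigma,\sigma')$ of permutations of $[n]=\{1,\dots,n\}$. A (classical) permutation $\tau\in S_n$ contains a pattern $\pi\in S_k$ if there are indices $c_1<\dots<c_k$ such that $\tau(c_1)\cdots\tau(c_k)$ is order-isomorphic to $\pi$, and avoids $\pi$ otherwise. A $3$-permutation $(\sigma,\sigma')$ avoids a pattern $\pi\in S_k$ if each of the three permutations $\sigma$, $\sigma'$, and $\sigma'\circ\sigma^{ -1}$ (where $(\sigma'\circ\sigma^{ -1})(i)=\sigma'(\sigma^{ -1}(i))$) avoids $\pi$. $S_n^2(\pi_1,\dots,\pi_m)$ denotes the set of $3$-permutations of size $n$ avoiding each of $\pi_1,\dots,\pi_m$. Patterns are written in one-line notation. -}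

module Defs where

open import Data.Nat using (ℕ; suc)
open import Data.Bool using (Bool; true; false; _∧_; _∨_; not)
open import Data.Fin using (Fin; _<?_; zero; suc)
open import Data.Fin.Properties using (_≟_)
open import Data.Vec using (Vec; lookup; allFin; _∷_; [])
open import Data.List using (List)
open import Data.Bool.ListAction using (all; any)
open import Relation.Nullary.Decidable using (⌊_⌋)
open import Relation.Binary.PropositionalEquality using (_≡_)
open import Data.Product using (Σ; _×_)

-- A permutation of [n] in one-line notation: the word τ(1)…τ(n),
-- stored as a vector of length n over Fin n (0-based values).
Word : ℕ → Set
Word n = Vec (Fin n) n

finList : (n : ℕ) → List (Fin n)
finList n = Data.Vec.toList (allFin n)

-- Boolean: the word is a permutation (all entries pairwise distinct;
-- length n over an n-element alphabet, hence a bijection).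
isPerm : ∀ {n} → Word n → Bool
isPerm {n} w =
  all (λ i → all (λ j → not ⌊ i <? j ⌋ ∨ not ⌊ lookup w i ≟ lookup w j ⌋)
                 (finList n))
      (finList n)

-- Composition (σ' ∘ σ⁻¹) in one-line notation:
-- (σ' ∘ σ⁻¹)(σ(i)) = σ'(i), i.e. position σ(i) holds value σ'(i).
-- For permutations σ this determines the word; we compute it by
-- searching for the i with σ(i) = p.
findIndex : ∀ {n} → Word n → Fin n → Fin n → Fin n
findIndex {n} σ p default = go (finList n)
  where
  go : List (Fin n) → Fin n
  go List.[] = default
  go (i List.∷ is) with ⌊ lookup σ i ≟ p ⌋
  ... | true  = i
  ... | false = go is

-- inverse word of σ (valid when σ is a permutation)
inverse : ∀ {n} → Word n → Word n
inverse σ = Data.Vec.map (λ p → findIndex σ p p) (allFin _)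

compose : ∀ {n} → Word n → Word n → Word n
compose τ ρ = Data.Vec.map (λ i → lookup τ (lookup ρ i)) (allFin _)

orderIso3 : ∀ {n} → Vec (Fin n) 3 → Vec (Fin 3) 3 → Bool
orderIso3 v π =
  all (λ a → all (λ b → eqB ⌊ lookup v a <? lookup v b ⌋ ⌊ lookup π a <? lookup π b ⌋)
                 (finList 3))
      (finList 3)
  where
  eqB : Bool → Bool → Bool
  eqB true true = true
  eqB false false = true
  eqB _ _ = false

contains3 : ∀ {n} → Word n → Vec (Fin 3) 3 → Bool
contains3 {n} w π =
  any (λ i → any (λ j → any (λ k →
        ⌊ i <? j ⌋ ∧ ⌊ j <? k ⌋ ∧
        orderIso3 (lookup w i ∷ lookup w j ∷ lookup w k ∷ []) π)
      (finList n)) (finList n)) (finList n)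

avoids3 : ∀ {n} → Word n → Vec (Fin 3) 3 → Bool
avoids3 w π = not (contains3 w π)

p132 : Vec (Fin 3) 3
p132 = zero ∷ suc (suc zero) ∷ suc zero ∷ []

p321 : Vec (Fin 3) 3
p321 = suc (suc zero) ∷ suc zero ∷ zero ∷ []

avoids3perm : ∀ {n} → Word n → Word n → Vec (Fin 3) 3 → Bool
avoids3perm σ σ' π =
  avoids3 σ π ∧ avoids3 σ' π ∧ avoids3 (compose σ' (inverse σ)) π

inS2-132-321 : ∀ {n} → Word n → Word n → Bool
inS2-132-321 σ σ' =
  isPerm σ ∧ isPerm σ' ∧ avoids3perm σ σ' p132 ∧ avoids3perm σ σ' p321

S2-132-321 : ℕ → Set
S2-132-321 n = Σ (Word n × Word n) λ p → inS2-132-321 (Data.Product.proj₁ p) (Data.Product.proj₂ p) ≡ true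

-- A permutation avoids 132 and 321 exactly when it is a rotation rot p m: the first p positions
-- go to [m, m + p), the next m to [0, m), and the rest is fixed. Equivalently it is the power
-- i ↦ i + m (mod L) of the L-cycle on [0, L), L = p + m. If σ, σ′ and σ′ ∘ σ⁻¹ are all rotations,
-- then σ or σ′ is the identity or both have the same length L: were σ′ longer, σ′ ∘ σ⁻¹ would have
-- to be σ′ itself. Conversely the powers of one cycle form a group, so S_n^2(132,321) consists of
-- (id, id) and the pairs of powers (a, b) ≠ (0, 0) of the L-cycle for L ≤ n. Those with L = n + 1
-- are (n + 1)² − 1 = n (n + 2) in number.
module Submission where

open import Defs
open import Data.Nat
open import Data.Nat.Properties
open import Data.Nat.DivMod using (_%_; %-distribˡ-+; m%n%n≡m%n; m%n<n; m%n≤n; n%n≡0; m<n⇒m%n≡m; [m+n]%n≡m%n)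
open import Data.Bool using (Bool; true; false; T; not; _∧_; _∨_)
open import Data.Bool.Properties as Bool using (T-∧; T-∨; T-≡)
open import Data.Bool.ListAction using (all; any)
open import Data.Fin as Fin using (Fin; toℕ; fromℕ<)
open import Data.Fin.Properties as Finₚ using (toℕ<n; toℕ-fromℕ<; toℕ-injective; 1↔⊤; +↔⊎; *↔×)
open import Data.Vec using (Vec; []; _∷_; lookup; tabulate; allFin)
open import Data.Vec.Properties using (lookup∘tabulate; lookup-map; lookup-allFin)
open import Data.Vec.Membership.Propositional.Properties using (∈-allFin⁺; ∈-toList⁺)
open import Data.List using (List; []; _∷_)
open import Data.List.Membership.Propositional using (_∈_; lose)
open import Data.List.Relation.Unary.All as All using (All)
open import Data.List.Relation.Unary.All.Properties using (all⁺; all⁻)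
open import Data.List.Relation.Unary.Any using (Any; here; there; satisfied)
open import Data.List.Relation.Unary.Any.Properties using (any⁺; any⁻)
open import Data.Unit using (⊤; tt)
open import Data.Empty using (⊥; ⊥-elim)
open import Data.Product using (Σ; ∃; ∃-syntax; ∃₂; _×_; _,_; proj₁; proj₂)
open import Data.Product.Properties using (,-injective)
open import Data.Sum using (_⊎_; inj₁; inj₂; [_,_])
open import Data.Sum.Function.Propositional using (_⊎-↔_)
open import Function using (_∘_; _⇔_; _↔_; Equivalence; mk⇔; mk↔ₛ′)
open import Function.Definitions using (Injective)
open import Function.Properties.Inverse using (↔-refl; ↔-sym; ↔-trans)
open import Axiom.UniquenessOfIdentityProofs using (module Decidable⇒UIP)
open import Relation.Nullary using (¬_; Dec; yes; no)
open import Relation.Nullary.Decidable using (⌊_⌋; toWitness; fromWitness; toWitnessFalse; fromWitnessFalse)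
open import Relation.Binary using (tri<; tri≈; tri>)
open import Relation.Binary.PropositionalEquality hiding ([_])

InjectiveOn : ℕ → (ℕ → ℕ) → Set
InjectiveOn n f = ∀ {i j} → i < n → j < n → f i ≡ f j → i ≡ j

Avoids132 : ℕ → (ℕ → ℕ) → Set
Avoids132 n f = ∀ {i j k} → i < j → j < k → k < n → f i < f k → f k < f j → ⊥

Avoids321 : ℕ → (ℕ → ℕ) → Set
Avoids321 n f = ∀ {i j k} → i < j → j < k → k < n → f k < f j → f j < f i → ⊥

EqualOn : ℕ → (ℕ → ℕ) → (ℕ → ℕ) → Set
EqualOn n f g = ∀ {i} → i < n → f i ≡ g i

record Avoider (n : ℕ) (f : ℕ → ℕ) : Set where
  field
    injective : InjectiveOn n f
    avoids132 : Avoids132 n f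
    avoids321 : Avoids321 n f

Avoider-resp : ∀ {n f g} → EqualOn n f g → Avoider n f → Avoider n g
Avoider-resp {n} {f} {g} f≗g av = record { injective = g-injective ; avoids132 = g-avoids132 ; avoids321 = g-avoids321 }
  where
  open Avoider av
  transport : ∀ {a b} → a < n → b < n → g a < g b → f a < f b
  transport a<n b<n = subst₂ _<_ (sym (f≗g a<n)) (sym (f≗g b<n))
  g-injective : InjectiveOn n g
  g-injective i<n j<n eq = injective i<n j<n (trans (f≗g i<n) (trans eq (sym (f≗g j<n))))
  g-avoids132 : Avoids132 n g
  g-avoids132 i<j j<k k<n up down = avoids132 i<j j<k k<n (transport i<n k<n up) (transport k<n j<n down)
    where
    j<n = <-trans j<k k<n
    i<n = <-trans i<j j<n
  g-avoids321 : Avoids321 n g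
  g-avoids321 i<j j<k k<n down₁ down₂ = avoids321 i<j j<k k<n (transport k<n j<n down₁) (transport j<n i<n down₂)
    where
    j<n = <-trans j<k k<n
    i<n = <-trans i<j j<n

record IsPermutationOn (n : ℕ) (f : ℕ → ℕ) : Set where
  field
    bounded    : ∀ {i} → i < n → f i < n
    injective  : InjectiveOn n f
    surjective : ∀ {v} → v < n → ∃[ i ] i < n × f i ≡ v

-- Rotations

data Block (p m i : ℕ) : Set where
  low  : i < p → Block p m i
  mid  : p ≤ i → i < p + m → Block p m i
  high : p + m ≤ i → Block p m i

block : ∀ p m i → Block p m i
block p m i with i <? p | i <? p + m
... | yes i<p | _        = low i<p
... | no i≮p  | yes i<pm = mid (≮⇒≥ i≮p) i<pm
... | no _    | no i≮pm  = high (≮⇒≥ i≮pm)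

-- rot p m is the one-line word m, m+1, …, m+p−1, 0, 1, …, m−1, p+m, p+m+1, … (0-based).
rot : ℕ → ℕ → ℕ → ℕ
rot p m i with block p m i
... | low _   = i + m
... | mid _ _ = i ∸ p
... | high _  = i

rot-low : ∀ {p m i} → i < p → rot p m i ≡ i + m
rot-low {p} {m} {i} i<p with block p m i
... | low _     = refl
... | mid p≤i _ = ⊥-elim (<⇒≱ i<p p≤i)
... | high pm≤i = ⊥-elim (<⇒≱ i<p (m+n≤o⇒m≤o p pm≤i))

rot-mid : ∀ {p m i} → p ≤ i → i < p + m → rot p m i ≡ i ∸ p
rot-mid {p} {m} {i} p≤i i<pm with block p m i
... | low i<p   = ⊥-elim (<⇒≱ i<p p≤i)
... | mid _ _   = refl
... | high pm≤i = ⊥-elim (<⇒≱ i<pm pm≤i)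

rot-high : ∀ {p m i} → p + m ≤ i → rot p m i ≡ i
rot-high {p} {m} {i} pm≤i with block p m i
... | low i<p    = ⊥-elim (<⇒≱ i<p (m+n≤o⇒m≤o p pm≤i))
... | mid _ i<pm = ⊥-elim (<⇒≱ i<pm pm≤i)
... | high _     = refl

m≤n<m+o⇒n∸m<o : ∀ {p m i} → p ≤ i → i < p + m → i ∸ p < m
m≤n<m+o⇒n∸m<o {p} {m} {i} p≤i i<pm = +-cancelˡ-< p (i ∸ p) m (subst (_< p + m) (sym (m+[n∸m]≡n p≤i)) i<pm)

rot-inverse : ∀ p m i → rot m p (rot p m i) ≡ i
rot-inverse p m i with block p m i
... | low i<p =
  trans (rot-mid {m} {p} (m≤n+m m i) (subst (i + m <_) (+-comm p m) (+-monoˡ-< m i<p))) (m+n∸n≡m i m)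
... | mid p≤i i<pm =
  trans (rot-low {m} {p} (m≤n<m+o⇒n∸m<o p≤i i<pm)) (m∸n+n≡m p≤i)
... | high pm≤i = rot-high {m} {p} (subst (_≤ i) (+-comm p m) pm≤i)

rot-injective : ∀ p m {i j} → rot p m i ≡ rot p m j → i ≡ j
rot-injective p m {i} {j} eq = begin
  i                     ≡⟨ rot-inverse p m i ⟨
  rot m p (rot p m i)   ≡⟨ cong (rot m p) eq ⟩
  rot m p (rot p m j)   ≡⟨ rot-inverse p m j ⟩
  j                     ∎
  where open ≡-Reasoning

rot-bounded : ∀ {p m n i} → p + m ≤ n → i < n → rot p m i < n
rot-bounded {p} {m} {n} {i} pm≤n i<n with block p m i
... | low i<p = <-≤-trans (+-monoˡ-< m i<p) pm≤n
... | mid p≤i i<pm = ≤-<-trans (m∸n≤m i p) i<n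
... | high pm≤i = i<n

rot-inversion : ∀ p m {i j} → i < j → rot p m j < rot p m i → i < p × p ≤ j × j < p + m
rot-inversion p m {i} {j} i<j inv with block p m i | block p m j
... | low i<p | mid p≤j j<pm = i<p , p≤j , j<pm
... | low _ | low _ = ⊥-elim (<⇒≯ inv (+-monoˡ-< m i<j))
... | low i<p | high pm≤j = ⊥-elim (<⇒≯ inv (<-≤-trans (+-monoˡ-< m i<p) pm≤j))
... | mid p≤i _ | low j<p = ⊥-elim (<⇒≱ (<-trans i<j j<p) p≤i)
... | mid _ _ | mid _ _ = ⊥-elim (<⇒≱ inv (∸-monoˡ-≤ p (<⇒≤ i<j)))
... | mid p≤i i<pm | high pm≤j = ⊥-elim (<⇒≱ inv (≤-trans (m∸n≤m i p) (<⇒≤ i<j)))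
... | high pm≤i | low j<p = ⊥-elim (<⇒≱ (<-trans i<j j<p) (m+n≤o⇒m≤o p pm≤i))
... | high pm≤i | mid _ j<pm = ⊥-elim (<⇒≱ (<-trans i<j j<pm) pm≤i)
... | high pm≤i | high pm≤j = ⊥-elim (<⇒≯ inv i<j)

rot-avoids321 : ∀ n p m → Avoids321 n (rot p m)
rot-avoids321 n p m i<j j<k _ inv₂₃ inv₁₂ with rot-inversion p m i<j inv₁₂ | rot-inversion p m j<k inv₂₃
... | _ , p≤j , _ | j<p , _ = <⇒≱ j<p p≤j

rot-avoids132 : ∀ n p m → Avoids132 n (rot p m)
rot-avoids132 n p m {i} {j} {k} i<j j<k _ up down with rot-inversion p m j<k down
... | j<p , p≤k , k<pm rewrite rot-low {p} {m} (<-trans i<j j<p) | rot-mid {p} {m} p≤k k<pm =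
  <⇒≱ up (≤-trans (<⇒≤ (m≤n<m+o⇒n∸m<o p≤k k<pm)) (m≤n+m m i))

rot-avoider : ∀ n p m → Avoider n (rot p m)
rot-avoider n p m = record
  { injective = λ _ _ → rot-injective p m
  ; avoids132 = rot-avoids132 n p m
  ; avoids321 = rot-avoids321 n p m
  }

rot-identityˡ : ∀ m i → rot 0 m i ≡ i
rot-identityˡ m i with block 0 m i
... | mid _ _ = refl
... | high _  = refl

rot-identityʳ : ∀ p i → rot p 0 i ≡ i
rot-identityʳ p i with block p 0 i
... | low _        = +-identityʳ i
... | mid p≤i i<p0 = ⊥-elim (<⇒≱ i<p0 (subst (_≤ i) (sym (+-identityʳ p)) p≤i))
... | high _       = refl

rot-last : ∀ p m → rot p (suc m) (p + m) ≡ m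
rot-last p m = trans (rot-mid {p} {suc m} (m≤m+n p m) (+-monoʳ-< p (n<1+n m))) (m+n∸m≡n p m)

rot-moves : ∀ p m {i} → i < suc p + suc m → rot (suc p) (suc m) i ≢ i
rot-moves p m {i} i<L with block (suc p) (suc m) i
... | low _        = <⇒≢ (m<m+n i z<s) ∘ sym
... | mid p≤i _    = <⇒≢ (∸-monoʳ-< {i} {suc p} {0} z<s p≤i)
... | high L≤i     = ⊥-elim (<⇒≱ i<L L≤i)

rot-≤-from : ∀ {p m j} → p ≤ j → rot p m j ≤ j
rot-≤-from {p} {m} {j} p≤j with block p m j
... | low j<p  = ⊥-elim (<⇒≱ j<p p≤j)
... | mid _ _  = m∸n≤m j p
... | high _   = ≤-refl

rot-earlier : ∀ {p m j v} → p ≤ j → v < rot p m j → rot m p v < j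
rot-earlier {p} {m} {j} {v} p≤j v< with block p m j
... | low j<p = ⊥-elim (<⇒≱ j<p p≤j)
... | mid p≤j j<pm rewrite rot-low {m} {p} (<-trans v< (m≤n<m+o⇒n∸m<o p≤j j<pm)) =
  subst (v + p <_) (m∸n+n≡m p≤j) (+-monoˡ-< p v<)
... | high pm≤j with block m p v
...   | low v<m = <-≤-trans (+-monoˡ-< p v<m) (subst (_≤ j) (+-comm p m) pm≤j)
...   | mid m≤v _ = ≤-<-trans (m∸n≤m v m) v<
...   | high _ = v<

-- Powers of a cycle

cyc : ℕ → ℕ → ℕ → ℕ
cyc zero    k i = i
cyc (suc l) k i with i <? suc l
... | yes _ = (i + k) % suc l
... | no _  = i

cyc-inside : ∀ {l k i} → i < suc l → cyc (suc l) k i ≡ (i + k) % suc l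
cyc-inside {l} {k} {i} i<L with i <? suc l
... | yes _   = refl
... | no i≮L  = ⊥-elim (i≮L i<L)

cyc-outside : ∀ {L k i} → L ≤ i → cyc L k i ≡ i
cyc-outside {zero}  _   = refl
cyc-outside {suc l} {k} {i} L≤i with i <? suc l
... | yes i<L = ⊥-elim (<⇒≱ i<L L≤i)
... | no _    = refl

[m%d+n]%d≡[m+n]%d : ∀ x y d .{{_ : NonZero d}} → (x % d + y) % d ≡ (x + y) % d
[m%d+n]%d≡[m+n]%d x y d = begin
  (x % d + y) % d             ≡⟨ %-distribˡ-+ (x % d) y d ⟩
  (x % d % d + y % d) % d     ≡⟨ cong (λ z → (z + y % d) % d) (m%n%n≡m%n x d) ⟩
  (x % d + y % d) % d         ≡⟨ %-distribˡ-+ x y d ⟨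
  (x + y) % d                 ∎
  where open ≡-Reasoning

cyc-∘ : ∀ L a b i → cyc L a (cyc L b i) ≡ cyc L (b + a) i
cyc-∘ zero    a b i = refl
cyc-∘ (suc l) a b i with i <? suc l
... | no i≮L  = cyc-outside (≮⇒≥ i≮L)
... | yes i<L = begin
  cyc (suc l) a ((i + b) % suc l)   ≡⟨ cyc-inside (m%n<n (i + b) (suc l)) ⟩
  ((i + b) % suc l + a) % suc l     ≡⟨ [m%d+n]%d≡[m+n]%d (i + b) a (suc l) ⟩
  (i + b + a) % suc l               ≡⟨ cong (_% suc l) (+-assoc i b a) ⟩
  (i + (b + a)) % suc l             ∎
  where open ≡-Reasoning

cyc-mod : ∀ l k i → cyc (suc l) k i ≡ cyc (suc l) (k % suc l) i
cyc-mod l k i with i <? suc l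
... | no _  = refl
... | yes _ = begin
  (i + k) % suc l                   ≡⟨ cong (_% suc l) (+-comm i k) ⟩
  (k + i) % suc l                   ≡⟨ [m%d+n]%d≡[m+n]%d k i (suc l) ⟨
  (k % suc l + i) % suc l           ≡⟨ cong (_% suc l) (+-comm (k % suc l) i) ⟩
  (i + k % suc l) % suc l           ∎
  where open ≡-Reasoning

cyc-identity : ∀ L i → cyc L 0 i ≡ i
cyc-identity zero    i = refl
cyc-identity (suc l) i with i <? suc l
... | yes i<L = trans (cong (_% suc l) (+-identityʳ i)) (m<n⇒m%n≡m i<L)
... | no _    = refl

cyc-period : ∀ L i → cyc L L i ≡ i
cyc-period zero    i = refl
cyc-period (suc l) i = begin
  cyc (suc l) (suc l) i             ≡⟨ cyc-mod l (suc l) i ⟩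
  cyc (suc l) (suc l % suc l) i     ≡⟨ cong (λ k → cyc (suc l) k i) (n%n≡0 (suc l)) ⟩
  cyc (suc l) 0 i                   ≡⟨ cyc-identity (suc l) i ⟩
  i                                 ∎
  where open ≡-Reasoning

cyc-inverse : ∀ {L k} i → k ≤ L → cyc L k (cyc L (L ∸ k) i) ≡ i
cyc-inverse {L} {k} i k≤L = begin
  cyc L k (cyc L (L ∸ k) i)         ≡⟨ cyc-∘ L k (L ∸ k) i ⟩
  cyc L (L ∸ k + k) i               ≡⟨ cong (λ s → cyc L s i) (m∸n+n≡m k≤L) ⟩
  cyc L L i                         ≡⟨ cyc-period L i ⟩
  i                                 ∎
  where open ≡-Reasoning

cyc-bounded : ∀ {L k n i} → L ≤ n → i < n → cyc L k i < n
cyc-bounded {zero}          _   i<n = i<n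
cyc-bounded {suc l} {k} {n} {i} L≤n i<n with i <? suc l
... | yes _ = <-≤-trans (m%n<n (i + k) (suc l)) L≤n
... | no _  = i<n

cyc-first : ∀ {l k} → k < suc l → cyc (suc l) k 0 ≡ k
cyc-first {l} {k} k<L = trans (cyc-inside {l} {k} z<s) (m<n⇒m%n≡m k<L)

cyc-moves-last : ∀ {l k} → 0 < k → k < suc l → cyc (suc l) k l ≢ l
cyc-moves-last {l} {suc k} _ k<L eq = <⇒≢ (≤-pred k<L) (begin
  k                        ≡⟨ m<n⇒m%n≡m (<-trans (n<1+n k) k<L) ⟨
  k % suc l                ≡⟨ [m+n]%n≡m%n k (suc l) ⟨
  (k + suc l) % suc l      ≡⟨ cong (_% suc l) (trans (+-suc k l) (cong suc (+-comm k l))) ⟩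
  (suc l + k) % suc l      ≡⟨ cong (_% suc l) (sym (+-suc l k)) ⟩
  (l + suc k) % suc l      ≡⟨ cyc-inside (n<1+n l) ⟨
  cyc (suc l) (suc k) l    ≡⟨ eq ⟩
  l                        ∎)
  where open ≡-Reasoning

rot≗cyc-suc : ∀ {p m l} i → p + m ≡ suc l → rot p m i ≡ cyc (suc l) m i
rot≗cyc-suc {p} {m} {l} i eq with block p m i
... | low i<p = sym (trans (cyc-inside (<-≤-trans i<p (subst (p ≤_) eq (m≤m+n p m))))
                           (m<n⇒m%n≡m (subst (i + m <_) eq (+-monoˡ-< m i<p))))
... | high pm≤i = sym (cyc-outside (subst (_≤ i) eq pm≤i))
... | mid p≤i i<pm = sym (begin
  cyc (suc l) m i               ≡⟨ cyc-inside (subst (i <_) eq i<pm) ⟩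
  (i + m) % suc l               ≡⟨ cong (λ z → (z + m) % suc l) (m∸n+n≡m p≤i) ⟨
  (i ∸ p + p + m) % suc l       ≡⟨ cong (_% suc l) (trans (+-assoc (i ∸ p) p m) (cong (i ∸ p +_) eq)) ⟩
  (i ∸ p + suc l) % suc l       ≡⟨ [m+n]%n≡m%n (i ∸ p) (suc l) ⟩
  (i ∸ p) % suc l               ≡⟨ m<n⇒m%n≡m (<-≤-trans (m≤n<m+o⇒n∸m<o p≤i i<pm) (subst (m ≤_) eq (m≤n+m m p))) ⟩
  i ∸ p                         ∎)
  where open ≡-Reasoning

rot≗cyc : ∀ p m i → rot p m i ≡ cyc (p + m) m i
rot≗cyc zero    zero    i = rot-identityˡ 0 i
rot≗cyc zero    (suc m) i = rot≗cyc-suc {0} {suc m} i refl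
rot≗cyc (suc p) m       i = rot≗cyc-suc {suc p} {m} i refl

cyc-rotation : ∀ L k → ∃₂ λ p m → p + m ≡ L × (∀ i → cyc L k i ≡ rot p m i)
cyc-rotation zero    k = 0 , 0 , refl , λ i → sym (rot-identityˡ 0 i)
cyc-rotation (suc l) k = suc l ∸ r , r , r-split , λ i → begin
  cyc (suc l) k i               ≡⟨ cyc-mod l k i ⟩
  cyc (suc l) r i               ≡⟨ cong (λ L → cyc L r i) r-split ⟨
  cyc (suc l ∸ r + r) r i       ≡⟨ rot≗cyc (suc l ∸ r) r i ⟨
  rot (suc l ∸ r) r i           ∎
  where
  open ≡-Reasoning
  r = k % suc l
  r-split : suc l ∸ r + r ≡ suc l
  r-split = m∸n+n≡m (m%n≤n k (suc l))

cyc-avoider : ∀ n L k → Avoider n (cyc L k)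
cyc-avoider n L k with cyc-rotation L k
... | p , m , _ , cyc≗rot = Avoider-resp (λ {i} _ → sym (cyc≗rot i)) (rot-avoider n p m)

-- Permutations avoiding 132 and 321

module RotationForm {n f} (perm : IsPermutationOn n f)
                    (no132 : Avoids132 n f) (no321 : Avoids321 n f) (0<n : 0 < n) where
  open IsPermutationOn perm

  p : ℕ
  p = proj₁ (surjective 0<n)

  p<n : p < n
  p<n = proj₁ (proj₂ (surjective 0<n))

  f-p : f p ≡ 0
  f-p = proj₂ (proj₂ (surjective 0<n))

  m : ℕ
  m = f 0

  f-positive : ∀ {i} → i < n → i ≢ p → 0 < f i
  f-positive i<n i≢p = n≢0⇒n>0 (λ fi≡0 → i≢p (injective i<n p<n (trans fi≡0 (sym f-p))))

  increasing-before : ∀ {i j} → i < j → j < p → f i < f j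
  increasing-before {i} {j} i<j j<p = ≤∧≢⇒< (≮⇒≥ descent) (<⇒≢ i<j ∘ injective i<n j<n)
    where
    j<n = <-trans j<p p<n
    i<n = <-trans i<j j<n
    descent : f j < f i → ⊥
    descent = no321 i<j j<p p<n (subst (_< f j) (sym f-p) (f-positive j<n (<⇒≢ j<p)))

  nondecreasing-before : ∀ {i j} → i ≤ j → j < p → f i ≤ f j
  nondecreasing-before i≤j j<p with m≤n⇒m<n∨m≡n i≤j
  ... | inj₁ i<j  = <⇒≤ (increasing-before i<j j<p)
  ... | inj₂ refl = ≤-refl

  nondecreasing-from : ∀ {i j} → p ≤ i → i ≤ j → j < n → f i ≤ f j
  nondecreasing-from {i} {j} p≤i i≤j j<n = ≮⇒≥ descent
    where
    descent : f j < f i → ⊥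
    descent fj<fi with m≤n⇒m<n∨m≡n p≤i | m≤n⇒m<n∨m≡n i≤j
    ... | _         | inj₂ refl = <-irrefl refl fj<fi
    ... | inj₂ refl | inj₁ _    = n≮0 (subst (f j <_) f-p fj<fi)
    ... | inj₁ p<i  | inj₁ i<j  =
      no132 p<i i<j j<n (subst (_< f j) (sym f-p) (f-positive j<n (<⇒≢ (<-trans p<i i<j) ∘ sym))) fj<fi

  Agree : ℕ → Set
  Agree j = ∀ {i} → i < j → f i ≡ rot p m i

  -- A value strictly between f i and f (1 + i) would sit beyond p and form a 132.
  agree-before : ∀ {j} → j < p → Agree j → f j ≡ rot p m j
  agree-before {zero}  0<p _     = sym (rot-low 0<p)
  agree-before {suc i} si<p agree = trans (≤-antisym (≮⇒≥ gap) lower) (sym (rot-low si<p))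
    where
    i<p = <-trans (n<1+n i) si<p
    fi : f i ≡ i + m
    fi = trans (agree (n<1+n i)) (rot-low i<p)
    lower : suc i + m ≤ f (suc i)
    lower = subst (_< f (suc i)) fi (increasing-before (n<1+n i) si<p)
    gap : suc i + m < f (suc i) → ⊥
    gap v<f with surjective (<-trans v<f (bounded (<-trans si<p p<n)))
    ... | q , q<n , fq with q ≤? i | q <? p
    ...   | yes q≤i | _ = 1+n≰n (subst (_≤ i) (+-cancelʳ-≡ m q (suc i) fq′) q≤i)
      where
      fq′ : q + m ≡ suc i + m
      fq′ = trans (sym (trans (agree (s≤s q≤i)) (rot-low (≤-<-trans q≤i i<p)))) fq
    ...   | no q≰i | yes q<p = <⇒≱ v<f (subst (f (suc i) ≤_) fq (nondecreasing-before (≰⇒> q≰i) q<p))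
    ...   | no q≰i | no q≮p  =
      no132 (n<1+n i) (<-≤-trans si<p (≮⇒≥ q≮p)) q<n
            (subst (_< f q) (sym fi) (subst (i + m <_) (sym fq) (n<1+n _))) (subst (_< f (suc i)) (sym fq) v<f)

  -- From p on, f is nondecreasing and every value below rot p m j is already used before j.
  agree-from : ∀ {j} → p ≤ j → j < n → Agree j → f j ≡ rot p m j
  agree-from {j} p≤j j<n agree with surjective (≤-<-trans (rot-≤-from {p} {m} p≤j) j<n)
  ... | q , q<n , fq = ≤-antisym upper (≮⇒≥ below)
    where
    upper : f j ≤ rot p m j
    upper with q <? j
    ... | yes q<j = ⊥-elim (<⇒≢ q<j (rot-injective p m (trans (sym (agree q<j)) fq)))
    ... | no q≮j  = subst (f j ≤_) fq (nondecreasing-from p≤j (≮⇒≥ q≮j) q<n)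
    below : f j < rot p m j → ⊥
    below fj< = <⇒≢ r<j (injective (<-trans r<j j<n) j<n (trans (agree r<j) (rot-inverse m p (f j))))
      where
      r<j : rot m p (f j) < j
      r<j = rot-earlier p≤j fj<

  agree : ∀ {j} → j ≤ n → Agree j
  agree {zero} _ ()
  agree {suc j} sj≤n {i} i<sj with m≤n⇒m<n∨m≡n (≤-pred i<sj)
  ... | inj₁ i<j  = agree (<⇒≤ sj≤n) i<j
  ... | inj₂ refl with p ≤? i
  ...   | yes p≤i = agree-from p≤i sj≤n (agree (<⇒≤ sj≤n))
  ...   | no p≰i  = agree-before (≰⇒> p≰i) (agree (<⇒≤ sj≤n))

  p+m≤n : p + m ≤ n
  p+m≤n with p in p≡
  ... | zero   = <⇒≤ (bounded 0<n)
  ... | suc p₀ = subst (_< n) (trans (agree (<⇒≤ p<n) p₀<p) (rot-low p₀<p)) (bounded (<-trans p₀<p p<n))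
    where
    p₀<p : p₀ < p
    p₀<p = subst (p₀ <_) (sym p≡) (n<1+n p₀)

  rotation : ∃₂ λ p m → p + m ≤ n × EqualOn n f (rot p m)
  rotation = p , m , p+m≤n , agree ≤-refl

avoider⇒rotation : ∀ {n f} → IsPermutationOn n f → Avoids132 n f → Avoids321 n f →
                   ∃₂ λ p m → p + m ≤ n × EqualOn n f (rot p m)
avoider⇒rotation {zero}  _    _     _     = 0 , 0 , z≤n , λ ()
avoider⇒rotation {suc n} perm no132 no321 = RotationForm.rotation perm no132 no321 z<s

-- Pairs of rotations whose quotient is a rotation

rot-nontrivial : ∀ q k {x} → rot q k x ≢ x → ∃₂ λ q₀ k₀ → q ≡ suc q₀ × k ≡ suc k₀
rot-nontrivial zero    k       moves = ⊥-elim (moves (rot-identityˡ k _))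
rot-nontrivial (suc q) zero    moves = ⊥-elim (moves (rot-identityʳ (suc q) _))
rot-nontrivial (suc q) (suc k) _     = q , k , refl , refl

-- Moving x to m′ < x forces x < q + k, and fixing x + 1 forces q + k ≤ x + 1.
rot-from-last-point : ∀ {q k p′ m′} → rot (suc q) (suc k) (suc p′ + m′) ≡ m′ →
  rot (suc q) (suc k) (suc p′ + suc m′) ≡ suc p′ + suc m′ → q ≡ p′ × k ≡ m′
rot-from-last-point {q} {k} {p′} {m′} τx τL′ = q≡p′ , k≡m′
  where
  x = suc p′ + m′
  x<K : x < suc q + suc k
  x<K = ≰⇒> λ K≤x → <⇒≢ (m<n+m m′ z<s) (trans (sym τx) (rot-high {suc q} {suc k} K≤x))
  K≡L′ : suc q + suc k ≡ suc p′ + suc m′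
  K≡L′ = ≤-antisym (≮⇒≥ λ L′<K → rot-moves q k L′<K τL′) (subst (_≤ suc q + suc k) (sym (+-suc (suc p′) m′)) x<K)
  x≡ : x ≡ suc q + k
  x≡ = suc-injective (trans (sym (+-suc (suc p′) m′)) (trans (sym K≡L′) (+-suc (suc q) k)))
  k≡m′ : k ≡ m′
  k≡m′ = trans (sym (rot-last (suc q) k)) (trans (cong (rot (suc q) (suc k)) (sym x≡)) τx)
  q≡p′ : q ≡ p′
  q≡p′ = suc-injective (+-cancelʳ-≡ (suc m′) (suc q) (suc p′) (trans (cong (λ k → suc q + suc k) (sym k≡m′)) K≡L′))

-- σ = rot (1 + p) (1 + m) fixes both points, so there τ agrees with σ′.
factor-beyond : ∀ {n p m p′ m′ q k} → suc p + suc m < suc p′ + suc m′ → suc p′ + suc m′ ≤ n → q + k ≤ n →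
  EqualOn n (rot q k ∘ rot (suc p) (suc m)) (rot (suc p′) (suc m′)) →
  rot q k (suc p′ + m′) ≡ m′ × rot q k (suc p′ + suc m′) ≡ suc p′ + suc m′
factor-beyond {n} {p} {m} {p′} {m′} {q} {k} L<L′ L′≤n K≤n τσ≗σ′ = τx , τL′
  where
  x = suc p′ + m′
  L′≡1+x : suc p′ + suc m′ ≡ suc x
  L′≡1+x = +-suc (suc p′) m′
  σ-fixes : ∀ {i} → suc p + suc m ≤ i → rot (suc p) (suc m) i ≡ i
  σ-fixes = rot-high {suc p} {suc m}
  τx : rot q k x ≡ m′
  τx = begin
    rot q k x                        ≡⟨ cong (rot q k) (σ-fixes (≤-pred (subst (suc p + suc m <_) L′≡1+x L<L′))) ⟨
    rot q k (rot (suc p) (suc m) x)  ≡⟨ τσ≗σ′ (subst (_≤ n) L′≡1+x L′≤n) ⟩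
    rot (suc p′) (suc m′) x          ≡⟨ rot-last (suc p′) m′ ⟩
    m′                               ∎
    where open ≡-Reasoning
  τL′ : rot q k (suc p′ + suc m′) ≡ suc p′ + suc m′
  τL′ with m≤n⇒m<n∨m≡n L′≤n
  ... | inj₂ L′≡n = rot-high {q} {k} (subst (q + k ≤_) (sym L′≡n) K≤n)
  ... | inj₁ L′<n = begin
    rot q k (suc p′ + suc m′)                        ≡⟨ cong (rot q k) (σ-fixes (<⇒≤ L<L′)) ⟨
    rot q k (rot (suc p) (suc m) (suc p′ + suc m′))  ≡⟨ τσ≗σ′ L′<n ⟩
    rot (suc p′) (suc m′) (suc p′ + suc m′)          ≡⟨ rot-high {suc p′} {suc m′} ≤-refl ⟩
    suc p′ + suc m′                                  ∎
    where open ≡-Reasoning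

-- If σ′ were longer than σ, then τ = σ′ ∘ σ⁻¹ would be σ′ itself, so σ would be the identity.
shorter-factor-impossible : ∀ {n p m p′ m′} q k →
  suc p + suc m < suc p′ + suc m′ → suc p′ + suc m′ ≤ n → q + k ≤ n →
  EqualOn n (rot q k ∘ rot (suc p) (suc m)) (rot (suc p′) (suc m′)) → ⊥
shorter-factor-impossible {n} {p} {m} {p′} {m′} q k L<L′ L′≤n K≤n τσ≗σ′
  with factor-beyond {q = q} {k} L<L′ L′≤n K≤n τσ≗σ′
... | τx , τL′ with rot-nontrivial q k (<⇒≢ (m<n+m m′ z<s) ∘ trans (sym τx))
... | q₀ , k₀ , refl , refl with rot-from-last-point {q₀} {k₀} τx τL′
... | refl , refl with rot-injective (suc p′) (suc m′) {suc m} {0} (τσ≗σ′ (<-≤-trans z<s L′≤n))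
... | ()

rotation-lengths-agree : ∀ {n} p m p′ m′ {q k} → suc p + suc m ≤ n → suc p′ + suc m′ ≤ n → q + k ≤ n →
  EqualOn n (rot q k ∘ rot (suc p) (suc m)) (rot (suc p′) (suc m′)) → suc p + suc m ≡ suc p′ + suc m′
rotation-lengths-agree {n} p m p′ m′ {q} {k} L≤n L′≤n K≤n τσ≗σ′
  with <-cmp (suc p + suc m) (suc p′ + suc m′)
... | tri< L<L′ _ _ = ⊥-elim (shorter-factor-impossible q k L<L′ L′≤n K≤n τσ≗σ′)
... | tri≈ _ L≡L′ _ = L≡L′
... | tri> _ _ L′<L = ⊥-elim (shorter-factor-impossible k q L′<L L≤n (subst (_≤ n) (+-comm q k) K≤n) τ⁻¹σ′≗σ)
  where
  τ⁻¹σ′≗σ : EqualOn n (rot k q ∘ rot (suc p′) (suc m′)) (rot (suc p) (suc m))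
  τ⁻¹σ′≗σ i<n = trans (cong (rot k q) (sym (τσ≗σ′ i<n))) (rot-inverse q k _)

CyclePowers : ℕ → (ℕ → ℕ) → (ℕ → ℕ) → Set
CyclePowers n f g = ∃[ L ] ∃₂ λ a b → L ≤ n × EqualOn n f (cyc L a) × EqualOn n g (cyc L b)

CyclePowers-swap : ∀ {n f g} → CyclePowers n f g → CyclePowers n g f
CyclePowers-swap (L , a , b , L≤n , f≗ , g≗) = L , b , a , L≤n , g≗ , f≗

identity-CyclePowers : ∀ {n f} p m → (∀ i → f i ≡ i) → p + m ≤ n → CyclePowers n f (rot p m)
identity-CyclePowers p m f≗id L≤n =
  p + m , 0 , m , L≤n , (λ {i} _ → trans (f≗id i) (sym (cyc-identity (p + m) i))) , (λ {i} _ → rot≗cyc p m i)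

rotations-CyclePowers : ∀ {n} p m p′ m′ {q k} → p + m ≤ n → p′ + m′ ≤ n → q + k ≤ n →
  EqualOn n (rot q k ∘ rot p m) (rot p′ m′) → CyclePowers n (rot p m) (rot p′ m′)
rotations-CyclePowers zero    m       p′ m′ _ L′≤n _ _ = identity-CyclePowers p′ m′ (rot-identityˡ m) L′≤n
rotations-CyclePowers (suc p) zero    p′ m′ _ L′≤n _ _ = identity-CyclePowers p′ m′ (rot-identityʳ (suc p)) L′≤n
rotations-CyclePowers (suc p) (suc m) zero m′ L≤n _ _ _ =
  CyclePowers-swap (identity-CyclePowers (suc p) (suc m) (rot-identityˡ m′) L≤n)
rotations-CyclePowers (suc p) (suc m) (suc p′) zero L≤n _ _ _ =
  CyclePowers-swap (identity-CyclePowers (suc p) (suc m) (rot-identityʳ (suc p′)) L≤n)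
rotations-CyclePowers (suc p) (suc m) (suc p′) (suc m′) {q} {k} L≤n L′≤n K≤n τσ≗σ′ =
  suc p + suc m , suc m , suc m′ , L≤n , (λ {i} _ → rot≗cyc (suc p) (suc m) i) , λ {i} _ → begin
    rot (suc p′) (suc m′) i          ≡⟨ rot≗cyc (suc p′) (suc m′) i ⟩
    cyc (suc p′ + suc m′) (suc m′) i ≡⟨ cong (λ L → cyc L (suc m′) i) (rotation-lengths-agree p m p′ m′ {q} {k} L≤n L′≤n K≤n τσ≗σ′) ⟨
    cyc (suc p + suc m) (suc m′) i   ∎
  where open ≡-Reasoning

-- Words are read as functions ℕ → ℕ (junk value 0 past the end).
lookupℕ : ∀ {n k} → Vec (Fin n) k → ℕ → ℕ
lookupℕ []       _       = 0
lookupℕ (x ∷ xs) zero    = toℕ x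
lookupℕ (x ∷ xs) (suc i) = lookupℕ xs i

lookupℕ-toℕ : ∀ {n k} (w : Vec (Fin n) k) (i : Fin k) → lookupℕ w (toℕ i) ≡ toℕ (lookup w i)
lookupℕ-toℕ (x ∷ w) Fin.zero    = refl
lookupℕ-toℕ (x ∷ w) (Fin.suc i) = lookupℕ-toℕ w i

lookupℕ-fromℕ< : ∀ {n k} (w : Vec (Fin n) k) {i} (i<k : i < k) → lookupℕ w i ≡ toℕ (lookup w (fromℕ< i<k))
lookupℕ-fromℕ< w {i} i<k = trans (cong (lookupℕ w) (sym (toℕ-fromℕ< i<k))) (lookupℕ-toℕ w (fromℕ< i<k))

lookupℕ-bounded : ∀ {n k} (w : Vec (Fin n) k) {i} → i < k → lookupℕ w i < n
lookupℕ-bounded w i<k = subst (_< _) (sym (lookupℕ-fromℕ< w i<k)) (toℕ<n _)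

lookupℕ-injective : ∀ {n k} (w : Vec (Fin n) k) → Injective _≡_ _≡_ (lookup w) → InjectiveOn k (lookupℕ w)
lookupℕ-injective w inj i<k j<k eq = begin
  _                         ≡⟨ toℕ-fromℕ< i<k ⟨
  toℕ (fromℕ< i<k)          ≡⟨ cong toℕ (inj (toℕ-injective (trans (sym (lookupℕ-fromℕ< w i<k)) (trans eq (lookupℕ-fromℕ< w j<k))))) ⟩
  toℕ (fromℕ< j<k)          ≡⟨ toℕ-fromℕ< j<k ⟩
  _                         ∎
  where open ≡-Reasoning

lookup-injective : ∀ {n k} (w : Vec (Fin n) k) → InjectiveOn k (lookupℕ w) → Injective _≡_ _≡_ (lookup w)
lookup-injective w inj {a} {b} eq = toℕ-injective (inj (toℕ<n a) (toℕ<n b)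
  (trans (lookupℕ-toℕ w a) (trans (cong toℕ eq) (sym (lookupℕ-toℕ w b)))))

word-ext : ∀ {n k} (w w′ : Vec (Fin n) k) → EqualOn k (lookupℕ w) (lookupℕ w′) → w ≡ w′
word-ext []      []        _  = refl
word-ext (x ∷ w) (x′ ∷ w′) eq = cong₂ _∷_ (toℕ-injective (eq z<s)) (word-ext w w′ (eq ∘ s<s))

tabulateℕ : ∀ {n} (f : ℕ → ℕ) → (∀ {i} → i < n → f i < n) → Word n
tabulateℕ f bounded = tabulate (λ i → fromℕ< (bounded (toℕ<n i)))

lookupℕ-tabulateℕ : ∀ {n} f (bounded : ∀ {i} → i < n → f i < n) → EqualOn n (lookupℕ (tabulateℕ f bounded)) f
lookupℕ-tabulateℕ f bounded i<n = begin
  lookupℕ (tabulateℕ f bounded) _                           ≡⟨ lookupℕ-fromℕ< (tabulateℕ f bounded) i<n ⟩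
  toℕ (lookup (tabulateℕ f bounded) (fromℕ< i<n))           ≡⟨ cong toℕ (lookup∘tabulate _ (fromℕ< i<n)) ⟩
  toℕ (fromℕ< (bounded (toℕ<n (fromℕ< i<n))))              ≡⟨ toℕ-fromℕ< _ ⟩
  f (toℕ (fromℕ< i<n))                                      ≡⟨ cong f (toℕ-fromℕ< i<n) ⟩
  f _                                                       ∎
  where open ≡-Reasoning

∈-finList : ∀ {n} (i : Fin n) → i ∈ finList n
∈-finList i = ∈-toList⁺ (∈-allFin⁺ i)

all-finList⁺ : ∀ {n} {p : Fin n → Bool} → T (all p (finList n)) → ∀ i → T (p i)
all-finList⁺ {n} {p} h i = All.lookup (all⁺ p (finList n) h) (∈-finList i)

all-finList⁻ : ∀ {n} {p : Fin n → Bool} → (∀ i → T (p i)) → T (all p (finList n))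
all-finList⁻ {n} {p} h = all⁻ p (All.universal h (finList n))

any-finList⁺ : ∀ {n} {p : Fin n → Bool} → T (any p (finList n)) → ∃ λ i → T (p i)
any-finList⁺ {n} {p} h = satisfied (any⁻ p (finList n) h)

any-finList⁻ : ∀ {n} {p : Fin n → Bool} i → T (p i) → T (any p (finList n))
any-finList⁻ {p = p} i h = any⁺ p (lose (∈-finList i) h)

T-not⇒¬T : ∀ {b} → T (not b) → ¬ T b
T-not⇒¬T {true}  ()
T-not⇒¬T {false} _ ()

¬T⇒T-not : ∀ {b} → ¬ T b → T (not b)
¬T⇒T-not {false} _   = _
¬T⇒T-not {true}  ¬tt = ¬tt _

isPerm-distinct : ∀ {n} (w : Word n) → T (isPerm w) → ∀ {a b} → a Fin.< b → lookup w a ≢ lookup w b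
isPerm-distinct w perm {a} {b} a<b =
  [ (λ a≮b → ⊥-elim (toWitnessFalse a≮b a<b)) , toWitnessFalse ] (Equivalence.to (T-∨ {not ⌊ a Fin.<? b ⌋}) (all-finList⁺ (all-finList⁺ perm a) b))

isPerm⇒injective : ∀ {n} (w : Word n) → T (isPerm w) → Injective _≡_ _≡_ (lookup w)
isPerm⇒injective w perm {a} {b} eq with Finₚ.<-cmp a b
... | tri< a<b _ _ = ⊥-elim (isPerm-distinct w perm a<b eq)
... | tri≈ _ a≡b _ = a≡b
... | tri> _ _ b<a = ⊥-elim (isPerm-distinct w perm b<a (sym eq))

injective⇒isPerm : ∀ {n} (w : Word n) → Injective _≡_ _≡_ (lookup w) → T (isPerm w)
injective⇒isPerm w inj = all-finList⁻ λ a → all-finList⁻ λ b → distinct a b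
  where
  distinct : ∀ a b → T (not ⌊ a Fin.<? b ⌋ ∨ not ⌊ lookup w a Finₚ.≟ lookup w b ⌋)
  distinct a b with a Fin.<? b
  ... | no _    = _
  ... | yes a<b = fromWitnessFalse (Finₚ.<⇒≢ a<b ∘ inj)

⌊⌋-true : ∀ {A : Set} (d : Dec A) → A → ⌊ d ⌋ ≡ true
⌊⌋-true (yes _) _ = refl
⌊⌋-true (no ¬a) a = ⊥-elim (¬a a)

⌊⌋-false : ∀ {A : Set} (d : Dec A) → ¬ A → ⌊ d ⌋ ≡ false
⌊⌋-false (yes a) ¬a = ⊥-elim (¬a a)
⌊⌋-false (no _)  _  = refl

-- The checks are unfolded in the order orderIso3 performs them; each refuted case makes it return false.
orderIso3-132⁻ : ∀ {n} {x y z : Fin n} → T (orderIso3 (x ∷ y ∷ z ∷ []) p132) → x Fin.< z × z Fin.< y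
orderIso3-132⁻ {x = x} {y} {z} iso with x Fin.<? x | x Fin.<? y | x Fin.<? z | y Fin.<? x | y Fin.<? y | y Fin.<? z | z Fin.<? x | z Fin.<? y
... | yes x<x | _     | _       | _     | _       | _     | _     | _       = ⊥-elim (Finₚ.<-irrefl refl x<x)
... | _       | _     | _       | _     | yes y<y | _     | _     | _       = ⊥-elim (Finₚ.<-irrefl refl y<y)
... | no _    | no _  | _       | _     | _       | _     | _     | _       = ⊥-elim iso
... | no _    | yes _ | no _    | _     | _       | _     | _     | _       = ⊥-elim iso
... | no _    | yes _ | yes _   | yes _ | _       | _     | _     | _       = ⊥-elim iso
... | no _    | yes _ | yes _   | no _  | no _    | yes _ | _     | _       = ⊥-elim iso
... | no _    | yes _ | yes _   | no _  | no _    | no _  | yes _ | _       = ⊥-elim iso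
... | no _    | yes _ | yes _   | no _  | no _    | no _  | no _  | no _    = ⊥-elim iso
... | no _    | yes _ | yes x<z | no _  | no _    | no _  | no _  | yes z<y = x<z , z<y

orderIso3-321⁻ : ∀ {n} {x y z : Fin n} → T (orderIso3 (x ∷ y ∷ z ∷ []) p321) → z Fin.< y × y Fin.< x
orderIso3-321⁻ {x = x} {y} {z} iso with x Fin.<? x | x Fin.<? y | x Fin.<? z | y Fin.<? x | y Fin.<? y | y Fin.<? z | z Fin.<? x | z Fin.<? y
... | yes x<x | _     | _     | _       | _       | _     | _     | _       = ⊥-elim (Finₚ.<-irrefl refl x<x)
... | _       | _     | _     | _       | yes y<y | _     | _     | _       = ⊥-elim (Finₚ.<-irrefl refl y<y)
... | no _    | yes _ | _     | _       | _       | _     | _     | _       = ⊥-elim iso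
... | no _    | no _  | yes _ | _       | _       | _     | _     | _       = ⊥-elim iso
... | no _    | no _  | no _  | no _    | _       | _     | _     | _       = ⊥-elim iso
... | no _    | no _  | no _  | yes _   | no _    | yes _ | _     | _       = ⊥-elim iso
... | no _    | no _  | no _  | yes _   | no _    | no _  | no _  | _       = ⊥-elim iso
... | no _    | no _  | no _  | yes _   | no _    | no _  | yes _ | no _    = ⊥-elim iso
... | no _    | no _  | no _  | yes y<x | no _    | no _  | yes _ | yes z<y = z<y , y<x

orderIso3-132 : ∀ {n} {x y z : Fin n} → x Fin.< z → z Fin.< y → T (orderIso3 (x ∷ y ∷ z ∷ []) p132)
orderIso3-132 {x = x} {y} {z} x<z z<y
  rewrite ⌊⌋-false (x Fin.<? x) (Finₚ.<-irrefl refl) | ⌊⌋-false (y Fin.<? y) (Finₚ.<-irrefl refl)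
        | ⌊⌋-false (z Fin.<? z) (Finₚ.<-irrefl refl)
        | ⌊⌋-true (x Fin.<? y) (Finₚ.<-trans x<z z<y) | ⌊⌋-true (x Fin.<? z) x<z | ⌊⌋-true (z Fin.<? y) z<y
        | ⌊⌋-false (y Fin.<? x) (Finₚ.<-asym (Finₚ.<-trans x<z z<y)) | ⌊⌋-false (z Fin.<? x) (Finₚ.<-asym x<z)
        | ⌊⌋-false (y Fin.<? z) (Finₚ.<-asym z<y) = _

orderIso3-321 : ∀ {n} {x y z : Fin n} → z Fin.< y → y Fin.< x → T (orderIso3 (x ∷ y ∷ z ∷ []) p321)
orderIso3-321 {x = x} {y} {z} z<y y<x
  rewrite ⌊⌋-false (x Fin.<? x) (Finₚ.<-irrefl refl) | ⌊⌋-false (y Fin.<? y) (Finₚ.<-irrefl refl)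
        | ⌊⌋-false (z Fin.<? z) (Finₚ.<-irrefl refl)
        | ⌊⌋-true (z Fin.<? x) (Finₚ.<-trans z<y y<x) | ⌊⌋-true (z Fin.<? y) z<y | ⌊⌋-true (y Fin.<? x) y<x
        | ⌊⌋-false (x Fin.<? z) (Finₚ.<-asym (Finₚ.<-trans z<y y<x)) | ⌊⌋-false (y Fin.<? z) (Finₚ.<-asym z<y)
        | ⌊⌋-false (x Fin.<? y) (Finₚ.<-asym y<x) = _

Occurrence : ∀ {n} → Word n → Vec (Fin 3) 3 → Set
Occurrence w π = ∃[ i ] ∃[ j ] ∃[ k ] i Fin.< j × j Fin.< k × T (orderIso3 (lookup w i ∷ lookup w j ∷ lookup w k ∷ []) π)

contains3⇔occurrence : ∀ {n} (w : Word n) π → T (contains3 w π) ⇔ Occurrence w π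
contains3⇔occurrence w π = mk⇔ elim intro
  where
  elim : T (contains3 w π) → Occurrence w π
  elim h with any-finList⁺ h
  ... | i , hᵢ with any-finList⁺ hᵢ
  ... | j , hⱼ with any-finList⁺ hⱼ
  ... | k , hₖ with Equivalence.to (T-∧ {⌊ i Fin.<? j ⌋}) hₖ
  ... | i<j , h′ with Equivalence.to (T-∧ {⌊ j Fin.<? k ⌋}) h′
  ... | j<k , iso = i , j , k , toWitness i<j , toWitness j<k , iso
  intro : Occurrence w π → T (contains3 w π)
  intro (i , j , k , i<j , j<k , iso) = any-finList⁻ i (any-finList⁻ j (any-finList⁻ k
    (Equivalence.from (T-∧ {⌊ i Fin.<? j ⌋}) (fromWitness i<j , Equivalence.from (T-∧ {⌊ j Fin.<? k ⌋}) (fromWitness j<k , iso)))))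

lookupℕ-< : ∀ {n k} (w : Vec (Fin n) k) {a b} → lookup w a Fin.< lookup w b → lookupℕ w (toℕ a) < lookupℕ w (toℕ b)
lookupℕ-< w {a} {b} = subst₂ _<_ (sym (lookupℕ-toℕ w a)) (sym (lookupℕ-toℕ w b))

<-lookupℕ : ∀ {n k} (w : Vec (Fin n) k) {i j} (i<k : i < k) (j<k : j < k) →
            lookupℕ w i < lookupℕ w j → lookup w (fromℕ< i<k) Fin.< lookup w (fromℕ< j<k)
<-lookupℕ w i<k j<k = subst₂ _<_ (lookupℕ-fromℕ< w i<k) (lookupℕ-fromℕ< w j<k)

fromℕ<-mono : ∀ {n i j} (i<n : i < n) (j<n : j < n) → i < j → fromℕ< i<n Fin.< fromℕ< j<n
fromℕ<-mono i<n j<n = subst₂ _<_ (sym (toℕ-fromℕ< i<n)) (sym (toℕ-fromℕ< j<n))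

module _ {n} (w : Word n) {i j k} (i<j : i < j) (j<k : j < k) (k<n : k < n) where
  private
    j<n = <-trans j<k k<n
    i<n = <-trans i<j j<n

  occurrence-132 : lookupℕ w i < lookupℕ w k → lookupℕ w k < lookupℕ w j → Occurrence w p132
  occurrence-132 up down = fromℕ< i<n , fromℕ< j<n , fromℕ< k<n ,
    fromℕ<-mono i<n j<n i<j , fromℕ<-mono j<n k<n j<k ,
    orderIso3-132 (<-lookupℕ w i<n k<n up) (<-lookupℕ w k<n j<n down)

  occurrence-321 : lookupℕ w k < lookupℕ w j → lookupℕ w j < lookupℕ w i → Occurrence w p321
  occurrence-321 down₁ down₂ = fromℕ< i<n , fromℕ< j<n , fromℕ< k<n ,
    fromℕ<-mono i<n j<n i<j , fromℕ<-mono j<n k<n j<k ,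
    orderIso3-321 (<-lookupℕ w k<n j<n down₁) (<-lookupℕ w j<n i<n down₂)

avoids3⇒Avoids132 : ∀ {n} (w : Word n) → T (avoids3 w p132) → Avoids132 n (lookupℕ w)
avoids3⇒Avoids132 w av i<j j<k k<n up down =
  T-not⇒¬T av (Equivalence.from (contains3⇔occurrence w p132) (occurrence-132 w i<j j<k k<n up down))

avoids3⇒Avoids321 : ∀ {n} (w : Word n) → T (avoids3 w p321) → Avoids321 n (lookupℕ w)
avoids3⇒Avoids321 w av i<j j<k k<n down₁ down₂ =
  T-not⇒¬T av (Equivalence.from (contains3⇔occurrence w p321) (occurrence-321 w i<j j<k k<n down₁ down₂))

Avoids132⇒avoids3 : ∀ {n} (w : Word n) → Avoids132 n (lookupℕ w) → T (avoids3 w p132)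
Avoids132⇒avoids3 w no132 = ¬T⇒T-not (refute ∘ Equivalence.to (contains3⇔occurrence w p132))
  where
  refute : Occurrence w p132 → ⊥
  refute (i , j , k , i<j , j<k , iso) with orderIso3-132⁻ iso
  ... | x<z , z<y = no132 i<j j<k (toℕ<n k) (lookupℕ-< w x<z) (lookupℕ-< w z<y)

Avoids321⇒avoids3 : ∀ {n} (w : Word n) → Avoids321 n (lookupℕ w) → T (avoids3 w p321)
Avoids321⇒avoids3 w no321 = ¬T⇒T-not (refute ∘ Equivalence.to (contains3⇔occurrence w p321))
  where
  refute : Occurrence w p321 → ⊥
  refute (i , j , k , i<j , j<k , iso) with orderIso3-321⁻ iso
  ... | z<y , y<x = no321 i<j j<k (toℕ<n k) (lookupℕ-< w z<y) (lookupℕ-< w y<x)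

injective⇒surjective : ∀ {n} (f : Fin n → Fin n) → Injective _≡_ _≡_ f → ∀ v → ∃ λ i → f i ≡ v
injective⇒surjective {suc n} f inj v with Finₚ.any? (λ i → f i Finₚ.≟ v)
... | yes hit = hit
... | no miss with Finₚ.pigeonhole (n<1+n n) (λ i → Fin.punchOut {i = v} (miss ∘ (i ,_) ∘ sym))
...   | i , j , i<j , eq = ⊥-elim (Finₚ.<⇒≢ i<j (inj (Finₚ.punchOut-injective {i = v} _ _ eq)))

Any-induction : ∀ {A : Set} {P : A → Set} {M : List A → Set} →
  (∀ x xs → P x ⊎ M xs → M (x ∷ xs)) → ∀ {xs} → Any P xs → M xs
Any-induction step (here px)   = step _ _ (inj₁ px)
Any-induction step (there pxs) = step _ _ (inj₂ (Any-induction step pxs))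

-- findIndex scans finList n with a local function that cannot be named outside Defs, so the
-- scanned positions in scan-step are left for Agda to infer.
module _ {n} (σ : Word n) (v d : Fin n) where
  mutual
    findIndex-finds : Any (λ i → lookup σ i ≡ v) (finList n) → lookup σ (findIndex σ v d) ≡ v
    findIndex-finds hit with finList n
    ... | xs = Any-induction scan-step hit

    scan-step : ∀ x xs → lookup σ x ≡ v ⊎ lookup σ _ ≡ v → lookup σ _ ≡ v
    scan-step x xs h with lookup σ x Finₚ.≟ v
    ... | yes σx≡v = σx≡v
    ... | no σx≢v  = [ ⊥-elim ∘ σx≢v , (λ found → found) ] h

lookup-compose : ∀ {n} (τ ρ : Word n) i → lookup (compose τ ρ) i ≡ lookup τ (lookup ρ i)
lookup-compose τ ρ i = trans (lookup-map i _ (allFin _)) (cong (λ j → lookup τ (lookup ρ j)) (lookup-allFin i))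

lookup-inverse : ∀ {n} (σ : Word n) i → lookup (inverse σ) i ≡ findIndex σ i i
lookup-inverse σ i = trans (lookup-map i _ (allFin _)) (cong (λ j → findIndex σ j j) (lookup-allFin i))

lookupℕ-compose-inverse : ∀ {n} (σ σ′ : Word n) (s : ℕ → ℕ) → Injective _≡_ _≡_ (lookup σ) →
  (∀ {x} → x < n → s x < n) → EqualOn n (lookupℕ σ ∘ s) (λ x → x) →
  EqualOn n (lookupℕ (compose σ′ (inverse σ))) (lookupℕ σ′ ∘ s)
lookupℕ-compose-inverse σ σ′ s inj s-bounded σs≗id {x} x<n = begin
  lookupℕ (compose σ′ (inverse σ)) x          ≡⟨ lookupℕ-fromℕ< (compose σ′ (inverse σ)) x<n ⟩
  toℕ (lookup (compose σ′ (inverse σ)) a)     ≡⟨ cong toℕ (lookup-compose σ′ (inverse σ) a) ⟩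
  toℕ (lookup σ′ (lookup (inverse σ) a))      ≡⟨ cong (toℕ ∘ lookup σ′) (lookup-inverse σ a) ⟩
  toℕ (lookup σ′ (findIndex σ a a))           ≡⟨ cong (toℕ ∘ lookup σ′) found ⟩
  toℕ (lookup σ′ b)                           ≡⟨ lookupℕ-fromℕ< σ′ (s-bounded x<n) ⟨
  lookupℕ σ′ (s x)                            ∎
  where
  open ≡-Reasoning
  a = fromℕ< x<n
  b = fromℕ< (s-bounded x<n)
  σb≡a : lookup σ b ≡ a
  σb≡a = toℕ-injective (begin
    toℕ (lookup σ b)   ≡⟨ lookupℕ-fromℕ< σ (s-bounded x<n) ⟨
    lookupℕ σ (s x)    ≡⟨ σs≗id x<n ⟩
    x                  ≡⟨ toℕ-fromℕ< x<n ⟨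
    toℕ a              ∎)
  found : findIndex σ a a ≡ b
  found = inj (trans (findIndex-finds σ a a (lose (∈-finList b) σb≡a)) (sym σb≡a))

record InS2 {n} (σ σ′ : Word n) : Set where
  field
    σ-avoider   : Avoider n (lookupℕ σ)
    σ′-avoider  : Avoider n (lookupℕ σ′)
    τ-avoids132 : Avoids132 n (lookupℕ (compose σ′ (inverse σ)))
    τ-avoids321 : Avoids321 n (lookupℕ (compose σ′ (inverse σ)))

T-∧³ : ∀ x y z → T (x ∧ y ∧ z) ⇔ (T x × T y × T z)
T-∧³ x y z = mk⇔ (λ h → let tx , h′ = Equivalence.to (T-∧ {x}) h in tx , Equivalence.to (T-∧ {y}) h′)
                 (λ (tx , ty , tz) → Equivalence.from (T-∧ {x}) (tx , Equivalence.from (T-∧ {y}) (ty , tz)))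

avoids3perm-checks : ∀ {n} (σ σ′ : Word n) π →
  T (avoids3perm σ σ′ π) ⇔ (T (avoids3 σ π) × T (avoids3 σ′ π) × T (avoids3 (compose σ′ (inverse σ)) π))
avoids3perm-checks σ σ′ π = T-∧³ (avoids3 σ π) (avoids3 σ′ π) (avoids3 (compose σ′ (inverse σ)) π)

inS2-checks : ∀ {n} (σ σ′ : Word n) →
  T (inS2-132-321 σ σ′) ⇔ (T (isPerm σ) × T (isPerm σ′) × T (avoids3perm σ σ′ p132 ∧ avoids3perm σ σ′ p321))
inS2-checks σ σ′ = T-∧³ (isPerm σ) (isPerm σ′) (avoids3perm σ σ′ p132 ∧ avoids3perm σ σ′ p321)

inS2⇔InS2 : ∀ {n} (σ σ′ : Word n) → inS2-132-321 σ σ′ ≡ true ⇔ InS2 σ σ′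
inS2⇔InS2 {n} σ σ′ = mk⇔ elim intro
  where
  τ = compose σ′ (inverse σ)
  avoider : ∀ w → T (isPerm w) → T (avoids3 w p132) → T (avoids3 w p321) → Avoider n (lookupℕ w)
  avoider w perm av₁₃₂ av₃₂₁ = record
    { injective = lookupℕ-injective w (isPerm⇒injective w perm)
    ; avoids132 = avoids3⇒Avoids132 w av₁₃₂
    ; avoids321 = avoids3⇒Avoids321 w av₃₂₁
    }
  elim : inS2-132-321 σ σ′ ≡ true → InS2 σ σ′
  elim h =
    let σ-perm , σ′-perm , av = Equivalence.to (inS2-checks σ σ′) (Equivalence.from T-≡ h)
        av₁₃₂ , av₃₂₁ = Equivalence.to (T-∧ {avoids3perm σ σ′ p132}) av
        σ₁₃₂ , σ′₁₃₂ , τ₁₃₂ = Equivalence.to (avoids3perm-checks σ σ′ p132) av₁₃₂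
        σ₃₂₁ , σ′₃₂₁ , τ₃₂₁ = Equivalence.to (avoids3perm-checks σ σ′ p321) av₃₂₁
    in record
      { σ-avoider   = avoider σ σ-perm σ₁₃₂ σ₃₂₁
      ; σ′-avoider  = avoider σ′ σ′-perm σ′₁₃₂ σ′₃₂₁
      ; τ-avoids132 = avoids3⇒Avoids132 τ τ₁₃₂
      ; τ-avoids321 = avoids3⇒Avoids321 τ τ₃₂₁
      }
  intro : InS2 σ σ′ → inS2-132-321 σ σ′ ≡ true
  intro m = Equivalence.to T-≡ (Equivalence.from (inS2-checks σ σ′) (perm σ σ-avoider , perm σ′ σ′-avoider ,
    Equivalence.from (T-∧ {avoids3perm σ σ′ p132})
      ( Equivalence.from (avoids3perm-checks σ σ′ p132)
          (Avoids132⇒avoids3 σ (avoids132 σ-avoider) , Avoids132⇒avoids3 σ′ (avoids132 σ′-avoider) , Avoids132⇒avoids3 τ τ-avoids132)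
      , Equivalence.from (avoids3perm-checks σ σ′ p321)
          (Avoids321⇒avoids3 σ (avoids321 σ-avoider) , Avoids321⇒avoids3 σ′ (avoids321 σ′-avoider) , Avoids321⇒avoids3 τ τ-avoids321))))
    where
    open InS2 m
    open Avoider
    perm : ∀ w → Avoider n (lookupℕ w) → T (isPerm w)
    perm w av = injective⇒isPerm w (lookup-injective w (injective av))

word-permutation : ∀ {n} (w : Word n) → InjectiveOn n (lookupℕ w) → IsPermutationOn n (lookupℕ w)
word-permutation w inj = record
  { bounded    = lookupℕ-bounded w
  ; injective  = inj
  ; surjective = λ v<n → hit v<n (injective⇒surjective (lookup w) (lookup-injective w inj) (fromℕ< v<n))
  }
  where
  hit : ∀ {v} (v<n : v < _) → ∃ (λ i → lookup w i ≡ fromℕ< v<n) → ∃[ i ] i < _ × lookupℕ w i ≡ v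
  hit v<n (i , wi≡v) = toℕ i , toℕ<n i , trans (lookupℕ-toℕ w i) (trans (cong toℕ wi≡v) (toℕ-fromℕ< v<n))

-- The bijection with shapes

CyclePowers-resp : ∀ {n f f′ g g′} → EqualOn n f f′ → EqualOn n g g′ → CyclePowers n f′ g′ → CyclePowers n f g
CyclePowers-resp f≗f′ g≗g′ (L , a , b , L≤n , f′≗ , g′≗) =
  L , a , b , L≤n , (λ i<n → trans (f≗f′ i<n) (f′≗ i<n)) , (λ i<n → trans (g≗g′ i<n) (g′≗ i<n))

word-rotation : ∀ {n} (w : Word n) → Avoider n (lookupℕ w) → ∃₂ λ p m → p + m ≤ n × EqualOn n (lookupℕ w) (rot p m)
word-rotation w av = avoider⇒rotation (word-permutation w injective) avoids132 avoids321
  where open Avoider av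

module Quotient {n} {σ σ′ : Word n} (member : InS2 σ σ′) (p m : ℕ) (p+m≤n : p + m ≤ n)
                (σ≗ : EqualOn n (lookupℕ σ) (rot p m)) where
  open InS2 member

  τ : Word n
  τ = compose σ′ (inverse σ)

  rot-m-p-bounded : ∀ {x} → x < n → rot m p x < n
  rot-m-p-bounded = rot-bounded {m} {p} (subst (_≤ n) (+-comm p m) p+m≤n)

  τ≗σ′∘σ⁻¹ : EqualOn n (lookupℕ τ) (lookupℕ σ′ ∘ rot m p)
  τ≗σ′∘σ⁻¹ = lookupℕ-compose-inverse σ σ′ (rot m p) (lookup-injective σ (Avoider.injective σ-avoider))
               rot-m-p-bounded (λ x<n → trans (σ≗ (rot-m-p-bounded x<n)) (rot-inverse m p _))

  τ-avoider : Avoider n (lookupℕ τ)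
  τ-avoider = record { injective = τ-injective ; avoids132 = τ-avoids132 ; avoids321 = τ-avoids321 }
    where
    τ-injective : InjectiveOn n (lookupℕ τ)
    τ-injective x<n y<n eq = rot-injective m p (Avoider.injective σ′-avoider (rot-m-p-bounded x<n) (rot-m-p-bounded y<n)
      (trans (sym (τ≗σ′∘σ⁻¹ x<n)) (trans eq (τ≗σ′∘σ⁻¹ y<n))))

  τ∘σ≗σ′ : ∀ {q k} → EqualOn n (lookupℕ τ) (rot q k) → EqualOn n (rot q k ∘ rot p m) (lookupℕ σ′)
  τ∘σ≗σ′ {q} {k} τ≗ {i} i<n = begin
    rot q k (rot p m i)         ≡⟨ τ≗ (rot-bounded {p} {m} p+m≤n i<n) ⟨
    lookupℕ τ (rot p m i)       ≡⟨ τ≗σ′∘σ⁻¹ (rot-bounded {p} {m} p+m≤n i<n) ⟩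
    lookupℕ σ′ (rot m p (rot p m i)) ≡⟨ cong (lookupℕ σ′) (rot-inverse p m i) ⟩
    lookupℕ σ′ i                ∎
    where open ≡-Reasoning

InS2⇒CyclePowers : ∀ {n} {σ σ′ : Word n} → InS2 σ σ′ → CyclePowers n (lookupℕ σ) (lookupℕ σ′)
InS2⇒CyclePowers {σ = σ} {σ′} member
  with word-rotation σ (InS2.σ-avoider member) | word-rotation σ′ (InS2.σ′-avoider member)
... | p , m , L≤n , σ≗ | p′ , m′ , L′≤n , σ′≗
  with word-rotation (Quotient.τ member p m L≤n σ≗) (Quotient.τ-avoider member p m L≤n σ≗)
... | q , k , K≤n , τ≗ = CyclePowers-resp σ≗ σ′≗ (rotations-CyclePowers p m p′ m′ {q} {k} L≤n L′≤n K≤n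
        (λ i<n → trans (Quotient.τ∘σ≗σ′ member p m L≤n σ≗ {q} {k} τ≗ i<n) (σ′≗ i<n)))

ShiftPair : ℕ → Set
ShiftPair l = Fin l × Fin (suc l) ⊎ Fin l

-- The pairs in [0, l]² other than (0, 0), as (1 + a, b) or (0, 1 + b).
shifts : ∀ {l} → ShiftPair l → ℕ × ℕ
shifts (inj₁ (a , b)) = suc (toℕ a) , toℕ b
shifts (inj₂ b)       = 0 , suc (toℕ b)

shifts-injective : ∀ {l} (s t : ShiftPair l) → shifts s ≡ shifts t → s ≡ t
shifts-injective (inj₁ (a , b)) (inj₁ (a′ , b′)) eq with ,-injective eq
... | a≡a′ , b≡b′ = cong₂ (λ x y → inj₁ (x , y)) (toℕ-injective (suc-injective a≡a′)) (toℕ-injective b≡b′)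
shifts-injective (inj₂ b) (inj₂ b′) eq = cong inj₂ (toℕ-injective (suc-injective (proj₂ (,-injective eq))))
shifts-injective (inj₁ _) (inj₂ _) ()
shifts-injective (inj₂ _) (inj₁ _) ()

shifts-< : ∀ {l} (s : ShiftPair l) → proj₁ (shifts s) < suc l × proj₂ (shifts s) < suc l
shifts-< (inj₁ (a , b)) = s≤s (toℕ<n a) , toℕ<n b
shifts-< (inj₂ b)       = z<s , s≤s (toℕ<n b)

Shape : ℕ → Set
Shape zero    = ⊤
Shape (suc n) = Shape n ⊎ ShiftPair n

record Powers : Set where
  constructor powers
  field
    period exp₁ exp₂ : ℕ

⟦_⟧ : ∀ {n} → Shape n → Powers
⟦_⟧ {zero}  _        = powers 0 0 0
⟦_⟧ {suc n} (inj₁ x) = ⟦ x ⟧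
⟦_⟧ {suc n} (inj₂ s) = powers (suc n) (proj₁ (shifts s)) (proj₂ (shifts s))

first second : ∀ {n} → Shape n → ℕ → ℕ
first  x = cyc (Powers.period ⟦ x ⟧) (Powers.exp₁ ⟦ x ⟧)
second x = cyc (Powers.period ⟦ x ⟧) (Powers.exp₂ ⟦ x ⟧)

period-≤ : ∀ {n} (x : Shape n) → Powers.period ⟦ x ⟧ ≤ n
period-≤ {zero}  _        = z≤n
period-≤ {suc n} (inj₁ x) = m≤n⇒m≤1+n (period-≤ x)
period-≤ {suc n} (inj₂ s) = ≤-refl

exp₁-≤ : ∀ {n} (x : Shape n) → Powers.exp₁ ⟦ x ⟧ ≤ Powers.period ⟦ x ⟧
exp₁-≤ {zero}  _        = z≤n
exp₁-≤ {suc n} (inj₁ x) = exp₁-≤ x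
exp₁-≤ {suc n} (inj₂ s) = <⇒≤ (proj₁ (shifts-< s))

cycle-powers-InS2 : ∀ {n L a b} (a≤L : a ≤ L) (L≤n : L ≤ n) →
  InS2 (tabulateℕ (cyc L a) (cyc-bounded L≤n)) (tabulateℕ (cyc L b) (cyc-bounded L≤n))
cycle-powers-InS2 {n} {L} {a} {b} a≤L L≤n = record
  { σ-avoider   = σ-avoider
  ; σ′-avoider  = Avoider-resp (sym ∘ σ′≗) (cyc-avoider n L b)
  ; τ-avoids132 = Avoider.avoids132 τ-avoider
  ; τ-avoids321 = Avoider.avoids321 τ-avoider
  }
  where
  σ σ′ : Word n
  σ  = tabulateℕ (cyc L a) (cyc-bounded L≤n)
  σ′ = tabulateℕ (cyc L b) (cyc-bounded L≤n)
  σ≗ : EqualOn n (lookupℕ σ) (cyc L a)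
  σ≗ = lookupℕ-tabulateℕ (cyc L a) (cyc-bounded L≤n)
  σ′≗ : EqualOn n (lookupℕ σ′) (cyc L b)
  σ′≗ = lookupℕ-tabulateℕ (cyc L b) (cyc-bounded L≤n)
  σ-avoider : Avoider n (lookupℕ σ)
  σ-avoider = Avoider-resp (sym ∘ σ≗) (cyc-avoider n L a)
  τ≗ : EqualOn n (lookupℕ (compose σ′ (inverse σ))) (cyc L (L ∸ a + b))
  τ≗ {x} x<n = begin
    lookupℕ (compose σ′ (inverse σ)) x   ≡⟨ lookupℕ-compose-inverse σ σ′ (cyc L (L ∸ a))
                                             (lookup-injective σ (Avoider.injective σ-avoider)) (cyc-bounded L≤n)
                                             (λ y<n → trans (σ≗ (cyc-bounded L≤n y<n)) (cyc-inverse _ a≤L)) x<n ⟩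
    lookupℕ σ′ (cyc L (L ∸ a) x)         ≡⟨ σ′≗ (cyc-bounded L≤n x<n) ⟩
    cyc L b (cyc L (L ∸ a) x)            ≡⟨ cyc-∘ L b (L ∸ a) x ⟩
    cyc L (L ∸ a + b) x                  ∎
    where open ≡-Reasoning
  τ-avoider : Avoider n (lookupℕ (compose σ′ (inverse σ)))
  τ-avoider = Avoider-resp (sym ∘ τ≗) (cyc-avoider n L (L ∸ a + b))

words : ∀ {n} → Shape n → Word n × Word n
words x = tabulateℕ (first x) (cyc-bounded (period-≤ x)) , tabulateℕ (second x) (cyc-bounded (period-≤ x))

words-first : ∀ {n} (x : Shape n) → EqualOn n (lookupℕ (proj₁ (words x))) (first x)
words-first x = lookupℕ-tabulateℕ (first x) (cyc-bounded (period-≤ x))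

words-second : ∀ {n} (x : Shape n) → EqualOn n (lookupℕ (proj₂ (words x))) (second x)
words-second x = lookupℕ-tabulateℕ (second x) (cyc-bounded (period-≤ x))

toS2 : ∀ {n} → Shape n → S2-132-321 n
toS2 x = words x , Equivalence.from (inS2⇔InS2 _ _) (cycle-powers-InS2 (exp₁-≤ x) (period-≤ x))

Decodes : ∀ {n} → Shape n → (ℕ → ℕ) → (ℕ → ℕ) → Set
Decodes x f g = ∀ i → first x i ≡ f i × second x i ≡ g i

embed : ∀ {m n} → m ≤′ n → Shape m → Shape n
embed ≤′-refl     x = x
embed (≤′-step h) x = inj₁ (embed h x)

embed-decodes : ∀ {m n f g} (h : m ≤′ n) (x : Shape m) → Decodes x f g → Decodes (embed h x) f g
embed-decodes ≤′-refl     x dec = dec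
embed-decodes (≤′-step h) x dec = embed-decodes h x dec

identity : ∀ {n} → Shape n
identity {zero}  = tt
identity {suc n} = inj₁ identity

identity-decodes : ∀ {n} → Decodes (identity {n}) (λ i → i) (λ i → i)
identity-decodes {zero}  i = refl , refl
identity-decodes {suc n} = identity-decodes {n}

atPeriod : ∀ {l} → Fin (suc l) → Fin (suc l) → Shape (suc l)
atPeriod Fin.zero    Fin.zero    = identity
atPeriod (Fin.suc a) b           = inj₂ (inj₁ (a , b))
atPeriod Fin.zero    (Fin.suc b) = inj₂ (inj₂ b)

atPeriod-decodes : ∀ {l} (a b : Fin (suc l)) → Decodes (atPeriod a b) (cyc (suc l) (toℕ a)) (cyc (suc l) (toℕ b))
atPeriod-decodes {l} Fin.zero Fin.zero i with identity-decodes {suc l} i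
... | first≗id , second≗id = trans first≗id (sym (cyc-identity (suc l) i)) , trans second≗id (sym (cyc-identity (suc l) i))
atPeriod-decodes (Fin.suc a) b           i = refl , refl
atPeriod-decodes Fin.zero    (Fin.suc b) i = refl , refl

encode : ∀ {n L} → L ≤ n → ℕ → ℕ → Shape n
encode {L = zero}  _   _ _ = identity
encode {L = suc l} L≤n a b = embed (≤⇒≤′ L≤n) (atPeriod (fromℕ< (m%n<n a (suc l))) (fromℕ< (m%n<n b (suc l))))

encode-decodes : ∀ {n L} (L≤n : L ≤ n) a b → Decodes (encode L≤n a b) (cyc L a) (cyc L b)
encode-decodes {n} {L = zero}  _   a b = identity-decodes {n}
encode-decodes {L = suc l} L≤n a b = embed-decodes (≤⇒≤′ L≤n) _ λ i →
  let first≗ , second≗ = atPeriod-decodes μ μ′ i in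
  trans first≗ (reduce a i) , trans second≗ (reduce b i)
  where
  μ  = fromℕ< (m%n<n a (suc l))
  μ′ = fromℕ< (m%n<n b (suc l))
  reduce : ∀ k i → cyc (suc l) (toℕ (fromℕ< (m%n<n k (suc l)))) i ≡ cyc (suc l) k i
  reduce k i = trans (cong (λ e → cyc (suc l) e i) (toℕ-fromℕ< (m%n<n k (suc l)))) (sym (cyc-mod l k i))

Shape-fixes-n : ∀ {n} (x : Shape n) → first x n ≡ n × second x n ≡ n
Shape-fixes-n x = cyc-outside (period-≤ x) , cyc-outside (period-≤ x)

-- A new shift pair is not (0, 0), so it moves the last point n of the new period suc n.
ShiftPair-moves-n : ∀ {n} (s : ShiftPair n) → first (inj₂ s) n ≢ n ⊎ second (inj₂ s) n ≢ n
ShiftPair-moves-n (inj₁ (a , b)) = inj₁ (cyc-moves-last z<s (s≤s (toℕ<n a)))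
ShiftPair-moves-n (inj₂ b)       = inj₂ (cyc-moves-last z<s (s≤s (toℕ<n b)))

first×second-injective : ∀ {n} (x y : Shape n) → EqualOn n (first x) (first y) → EqualOn n (second x) (second y) → x ≡ y
first×second-injective {zero}  _        _        _  _  = refl
first×second-injective {suc n} (inj₁ x) (inj₁ y) f≗ g≗ = cong inj₁ (first×second-injective x y (f≗ ∘ m<n⇒m<1+n) (g≗ ∘ m<n⇒m<1+n))
first×second-injective {suc n} (inj₁ x) (inj₂ t) f≗ g≗ = ⊥-elim (old≢new x t f≗ g≗)
  where
  old≢new : ∀ (x : Shape n) t → EqualOn (suc n) (first (inj₁ x)) (first (inj₂ t)) → EqualOn (suc n) (second (inj₁ x)) (second (inj₂ t)) → ⊥
  old≢new x t f≗ g≗ with ShiftPair-moves-n t | Shape-fixes-n x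
  ... | inj₁ moves | fixes , _ = moves (trans (sym (f≗ (n<1+n n))) fixes)
  ... | inj₂ moves | _ , fixes = moves (trans (sym (g≗ (n<1+n n))) fixes)
first×second-injective {suc n} (inj₂ s) (inj₁ y) f≗ g≗ = sym (first×second-injective (inj₁ y) (inj₂ s) (sym ∘ f≗) (sym ∘ g≗))
first×second-injective {suc n} (inj₂ s) (inj₂ t) f≗ g≗ =
  cong inj₂ (shifts-injective s t (cong₂ _,_ (at-0 (proj₁ (shifts-< s)) (proj₁ (shifts-< t)) (f≗ z<s))
                                           (at-0 (proj₂ (shifts-< s)) (proj₂ (shifts-< t)) (g≗ z<s))))
  where
  at-0 : ∀ {e e′} → e < suc n → e′ < suc n → cyc (suc n) e 0 ≡ cyc (suc n) e′ 0 → e ≡ e′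
  at-0 e< e′< eq = trans (sym (cyc-first e<)) (trans eq (cyc-first e′<))

encode-CyclePowers : ∀ {n f g} → CyclePowers n f g → Shape n
encode-CyclePowers (L , a , b , L≤n , _) = encode L≤n a b

encode-CyclePowers-decodes : ∀ {n f g} (cp : CyclePowers n f g) →
  EqualOn n (first (encode-CyclePowers cp)) f × EqualOn n (second (encode-CyclePowers cp)) g
encode-CyclePowers-decodes (L , a , b , L≤n , f≗ , g≗) =
  (λ {i} i<n → trans (proj₁ (encode-decodes L≤n a b i)) (sym (f≗ i<n))) ,
  (λ {i} i<n → trans (proj₂ (encode-decodes L≤n a b i)) (sym (g≗ i<n)))

S2⇒CyclePowers : ∀ {n} (s : S2-132-321 n) → CyclePowers n (lookupℕ (proj₁ (proj₁ s))) (lookupℕ (proj₂ (proj₁ s)))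
S2⇒CyclePowers ((σ , σ′) , h) = InS2⇒CyclePowers (Equivalence.to (inS2⇔InS2 σ σ′) h)

fromS2 : ∀ {n} → S2-132-321 n → Shape n
fromS2 s = encode-CyclePowers (S2⇒CyclePowers s)

fromS2-decodes : ∀ {n} (s : S2-132-321 n) →
  EqualOn n (first (fromS2 s)) (lookupℕ (proj₁ (proj₁ s))) × EqualOn n (second (fromS2 s)) (lookupℕ (proj₂ (proj₁ s)))
fromS2-decodes s = encode-CyclePowers-decodes (S2⇒CyclePowers s)

S2-≡ : ∀ {n} {s t : S2-132-321 n} → proj₁ s ≡ proj₁ t → s ≡ t
S2-≡ {s = w , p} {.w , q} refl = cong (w ,_) (Decidable⇒UIP.≡-irrelevant Bool._≟_ p q)

toS2-fromS2 : ∀ {n} (s : S2-132-321 n) → toS2 (fromS2 s) ≡ s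
toS2-fromS2 {n} s@((σ , σ′) , _) =
  S2-≡ (cong₂ _,_ (word-ext (proj₁ (words x)) σ first≗) (word-ext (proj₂ (words x)) σ′ second≗))
  where
  x = fromS2 s
  first≗ : EqualOn n (lookupℕ (proj₁ (words x))) (lookupℕ σ)
  first≗ i<n = trans (words-first x i<n) (proj₁ (fromS2-decodes s) i<n)
  second≗ : EqualOn n (lookupℕ (proj₂ (words x))) (lookupℕ σ′)
  second≗ i<n = trans (words-second x i<n) (proj₂ (fromS2-decodes s) i<n)

fromS2-toS2 : ∀ {n} (x : Shape n) → fromS2 (toS2 x) ≡ x
fromS2-toS2 x = first×second-injective (fromS2 (toS2 x)) x
  (λ i<n → trans (proj₁ (fromS2-decodes (toS2 x)) i<n) (words-first x i<n))
  (λ i<n → trans (proj₂ (fromS2-decodes (toS2 x)) i<n) (words-second x i<n))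

Shape↔S2 : ∀ n → Shape n ↔ S2-132-321 n
Shape↔S2 n = mk↔ₛ′ toS2 fromS2 toS2-fromS2 fromS2-toS2

-- Counting

size : ℕ → ℕ
size zero    = 1
size (suc n) = size n + n * (n + 2)

-- n (n + 2) = (n + 1)² − 1 counts the pairs of shifts modulo n + 1 other than (0, 0).
ShiftPair↔Fin : ∀ n → ShiftPair n ↔ Fin (n * (n + 2))
ShiftPair↔Fin n = subst (λ k → ShiftPair n ↔ Fin k) count (↔-trans (↔-sym *↔× ⊎-↔ ↔-refl) (↔-sym +↔⊎))
  where
  open ≡-Reasoning
  count : n * suc n + n ≡ n * (n + 2)
  count = begin
    n * suc n + n       ≡⟨ +-comm (n * suc n) n ⟩
    n + n * suc n       ≡⟨ *-suc n (suc n) ⟨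
    n * (2 + n)         ≡⟨ cong (n *_) (+-comm 2 n) ⟩
    n * (n + 2)         ∎

Shape↔Fin : ∀ n → Shape n ↔ Fin (size n)
Shape↔Fin zero    = ↔-sym 1↔⊤
Shape↔Fin (suc n) = ↔-trans (Shape↔Fin n ⊎-↔ ShiftPair↔Fin n) (↔-sym +↔⊎)

theorem3p2 : Σ (ℕ → ℕ) λ a →
    ((n : ℕ) → n ≥ 1 → S2-132-321 n ↔ Fin (a n)) ×
    (a 1 ≡ 1) ×
    ((n : ℕ) → n ≥ 1 → a (suc n) ≡ a n + n * (n + 2))
-- The bijection also holds for n = 0.
theorem3p2 = size , (λ n _ → ↔-trans (↔-sym (Shape↔S2 n)) (Shape↔Fin n)) , refl , (λ n _ → refl)
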